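{- Let $\Omega$ be a finite set, $\mathcal{C}$ a set of subsets of $\Omega$, and $\mathcal{C}^+$ the set consisting of all members of $\mathcal{C}$ other than $\emptyset$, together with all singletons $\{a\}$ ($a\in\Omega$). Then the following are equivalent: (i) there exists a total ordering $\leq$ of $\Omega$ under which all members of $\mathcal{C}$ are convex; (ii) the intersection graph of $\mathcal{C}^+$ is an interval graph, i.e., it is isomorphic to the intersection graph of a set of intervals $[s,t]=\{x\in\mathbb{R}: s\leq x\leq t\}$ ($s<t$ real) of the real line.
   Context: A subset $A$ of a totally ordered set $(\Omega,\leq)$ is convex if $p\leq q\leq r$ with $p,r\in A$ implies $q\in A$. The intersection graph of a set $\mathcal{S}$ of sets is the graph with vertex set $\mathcal{S}$ and an edge between distinct $A,B\in\mathcal{S}$ iff $A\cap B\neq\emptyset$.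
   Formalization: In (ii) the intervals $[s,t]$ are intervals of the rationals with rational endpoints rather than intervals of the real line. -}

module Defs where

open import Level using (0ℓ)
open import Data.Nat using (ℕ)
open import Data.Fin using (Fin)
open import Data.Fin.Subset using (Subset; _∈_; _∩_; Nonempty; ⁅_⁆)
open import Data.Product using (Σ; ∃; _×_; proj₁)
open import Data.Sum using (_⊎_)
open import Relation.Unary using (Pred)
open import Relation.Binary using (Rel; IsTotalOrder)
open import Relation.Binary.PropositionalEquality using (_≡_; _≢_)
open import Data.Rational using (ℚ) renaming (_≤_ to _≤ℚ_; _<_ to _<ℚ_)
open import Function.Bundles using (_⇔_)

-- Ω is the finite set Fin n; a subset of Ω is a Data.Fin.Subset.

Convex : ∀ {n} → Rel (Fin n) 0ℓ → Subset n → Set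
Convex _≼_ A = ∀ p q r → p ∈ A → r ∈ A → p ≼ q → q ≼ r → q ∈ A

Plus : ∀ {n} → Pred (Subset n) 0ℓ → Pred (Subset n) 0ℓ
Plus C A = (C A × Nonempty A) ⊎ (∃ λ a → A ≡ ⁅ a ⁆)

record Interval : Set where
  field
    lo hi : ℚ
    lo<hi : lo <ℚ hi
open Interval public

_∈ᵢ_ : ℚ → Interval → Set
x ∈ᵢ I = (lo I ≤ℚ x) × (x ≤ℚ hi I)

Meet : Interval → Interval → Set
Meet I J = ∃ λ x → (x ∈ᵢ I) × (x ∈ᵢ J)

-- The intersection graph of the set of sets {A | P A} (vertices: Σ (Subset n) P,
-- identified by their underlying subset) is isomorphic to the intersection graph
-- of a set of intervals: an assignment f of intervals that is injective (as sets
-- of points) and maps adjacency (A ≠ B, A ∩ B ≠ ∅) exactly to adjacency of intervals.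
IsIntervalGraph : ∀ {n} → Pred (Subset n) 0ℓ → Set
IsIntervalGraph {n} P =
  ∃ λ (f : Σ (Subset n) P → Interval) →
    (∀ v w → (∀ x → (x ∈ᵢ f v) ⇔ (x ∈ᵢ f w)) → proj₁ v ≡ proj₁ w) ×
    (∀ v w → proj₁ v ≢ proj₁ w →
       (Nonempty (proj₁ v ∩ proj₁ w) ⇔ Meet (f v) (f w)))

{-# OPTIONS --safe #-}
-- Given a total order, send a nonempty convex set with least element b and greatest element t
-- to the interval [2 rank b, 2 rank t + 1]. Two such sets meet iff the least element of each lies
-- below the greatest element of the other, which is exactly when their intervals meet; and the
-- interval determines b and t, hence the set. Conversely, the intervals of distinct singletons are
-- disjoint, so ordering points by the left ends of these intervals is a total order. If p ≤ q ≤ r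
-- with p, r ∈ A, the interval of A meets those of p and r, so it contains the left end of the
-- interval of q, which forces q ∈ A.
module Submission where

open import Defs
open import Level using (0ℓ)
open import Data.Bool using () renaming (_≟_ to _≟ᵇ_)
open import Data.Nat using (ℕ; suc; _+_; _*_; _≤_; _<_; s≤s; s≤s⁻¹)
open import Data.Nat.Properties
  using (≤-reflexive; m≤n⇒m≤1+n; <⇒≱; n<1+n; *-suc; *-monoʳ-≤; *-cancelˡ-<; *-cancelˡ-≡;
         suc-injective; module ≤-Reasoning)
open import Data.Integer as ℤ using (+_; +≤+; +<+)
open import Data.Integer.Properties using (*-identityʳ; drop‿+≤+; +-injective)
open import Data.Rational using (ℚ; ↥_; *≤*; *<*) renaming (_≤_ to _≤ℚ_; _<_ to _<ℚ_)
open import Data.Rational.Literals using (fromℤ)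
import Data.Rational.Properties as ℚ
open import Data.Fin using (Fin)
open import Data.Fin.Properties using (_≟_)
open import Data.Fin.Subset using (Subset; _∈_; _∩_; _⊆_; _⊂_; Nonempty; ⁅_⁆; ∣_∣)
open import Data.Fin.Subset.Properties
  using (_∈?_; x∈⁅x⁆; x∈⁅y⁆⇒x≡y; x∈p∩q⁺; x∈p∩q⁻; ⊆-antisym; p⊆q⇒∣p∣≤∣q∣; p⊂q⇒∣p∣<∣q∣)
open import Data.Vec using (tabulate)
open import Data.Vec.Properties using (≡-dec; lookup∘tabulate; []=⇒lookup; lookup⇒[]=)
open import Data.List using (List; filter; allFin)
open import Data.List.Relation.Unary.All using (lookup)
open import Data.List.Relation.Unary.All.Properties using (all-filter)
open import Data.List.Membership.Propositional using () renaming (_∈_ to _∈ˡ_)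
open import Data.List.Membership.Propositional.Properties using (∈-filter⁺; ∈-allFin)
import Data.List.Extrema
open import Data.Product using (Σ; ∃; _×_; _,_; proj₁; proj₂)
open import Data.Sum using (inj₁; inj₂)
open import Function using (_∘_; _on_; id)
open import Function.Bundles using (_⇔_; mk⇔; Equivalence)
open import Function.Definitions using (Injective)
open import Relation.Unary using (Pred)
open import Relation.Nullary using (yes; no; does; contradiction)
open import Relation.Nullary.Decidable using (dec-true; proof)
open import Relation.Nullary.Reflects using (Reflects; invert)
open import Relation.Binary
  using (Rel; IsTotalOrder; TotalOrder; DecidableEquality; Decidable; Antisymmetric)
open import Relation.Binary.Consequences using (total∧dec⇒dec)
open import Relation.Binary.Morphism.Structures using (IsOrderMonomorphism)
import Relation.Binary.Morphism.OrderMonomorphism as OrderMonomorphism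
open import Relation.Binary.PropositionalEquality
  using (_≡_; _≢_; refl; sym; trans; cong; subst; subst₂)

fromℕ : ℕ → ℚ
fromℕ n = fromℤ (+ n)

fromℕ-mono-≤ : ∀ {m n} → m ≤ n → fromℕ m ≤ℚ fromℕ n
fromℕ-mono-≤ {m} {n} m≤n =
  *≤* (subst₂ ℤ._≤_ (sym (*-identityʳ (+ m))) (sym (*-identityʳ (+ n))) (+≤+ m≤n))

fromℕ-mono-< : ∀ {m n} → m < n → fromℕ m <ℚ fromℕ n
fromℕ-mono-< {m} {n} m<n =
  *<* (subst₂ ℤ._<_ (sym (*-identityʳ (+ m))) (sym (*-identityʳ (+ n))) (+<+ m<n))

fromℕ-cancel-≤ : ∀ {m n} → fromℕ m ≤ℚ fromℕ n → m ≤ n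
fromℕ-cancel-≤ {m} {n} m≤n =
  drop‿+≤+ (subst₂ ℤ._≤_ (*-identityʳ (+ m)) (*-identityʳ (+ n)) (ℚ.drop-*≤* m≤n))

fromℕ-injective : ∀ {m n} → fromℕ m ≡ fromℕ n → m ≡ n
fromℕ-injective = +-injective ∘ cong ↥_

lo∈ : ∀ J → lo J ∈ᵢ J
lo∈ J = ℚ.≤-refl , ℚ.<⇒≤ (lo<hi J)

hi∈ : ∀ J → hi J ∈ᵢ J
hi∈ J = ℚ.<⇒≤ (lo<hi J) , ℚ.≤-refl

Meet-sym : ∀ I J → Meet I J → Meet J I
Meet-sym _ _ (x , x∈I , x∈J) = x , x∈J , x∈I

meet⇒lo≤hi : ∀ I J → Meet I J → lo I ≤ℚ hi J
meet⇒lo≤hi _ _ (x , (lo≤x , _) , (_ , x≤hi)) = ℚ.≤-trans lo≤x x≤hi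

samePoints⇒≡ends : ∀ I J → (∀ x → x ∈ᵢ I ⇔ x ∈ᵢ J) → lo I ≡ lo J × hi I ≡ hi J
samePoints⇒≡ends I J I≗J =
  ℚ.≤-antisym (proj₁ (J⊆I (lo∈ J))) (proj₁ (I⊆J (lo∈ I))) ,
  ℚ.≤-antisym (proj₂ (I⊆J (hi∈ I))) (proj₂ (J⊆I (hi∈ J)))
  where
  I⊆J : ∀ {x} → x ∈ᵢ I → x ∈ᵢ J
  I⊆J = Equivalence.to (I≗J _)
  J⊆I : ∀ {x} → x ∈ᵢ J → x ∈ᵢ I
  J⊆I = Equivalence.from (I≗J _)

2*m≤1+2*n⇒m≤n : ∀ {m n} → 2 * m ≤ suc (2 * n) → m ≤ n
2*m≤1+2*n⇒m≤n {m} {n} 2m≤1+2n = s≤s⁻¹ (*-cancelˡ-< 2 m (suc n) (begin-strict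
  2 * m        ≤⟨ 2m≤1+2n ⟩
  suc (2 * n)  <⟨ n<1+n _ ⟩
  2 + 2 * n    ≡⟨ *-suc 2 n ⟨
  2 * suc n    ∎))
  where open ≤-Reasoning

-- Element k is represented by the point 2k; the extra 1 makes singletons non-degenerate.
span : ∀ m n → m ≤ n → Interval
span m n m≤n = record
  { lo = fromℕ (2 * m)
  ; hi = fromℕ (suc (2 * n))
  ; lo<hi = fromℕ-mono-< (s≤s (*-monoʳ-≤ 2 m≤n))
  }

even∈span : ∀ {m n k} (m≤n : m ≤ n) → m ≤ k → k ≤ n → fromℕ (2 * k) ∈ᵢ span m n m≤n
even∈span _ m≤k k≤n = fromℕ-mono-≤ (*-monoʳ-≤ 2 m≤k) , fromℕ-mono-≤ (m≤n⇒m≤1+n (*-monoʳ-≤ 2 k≤n))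

_≟ₛ_ : ∀ {n} → DecidableEquality (Subset n)
_≟ₛ_ = ≡-dec _≟ᵇ_

⁅⁆-convex : ∀ {n} {_≼_ : Rel (Fin n) 0ℓ} → Antisymmetric _≡_ _≼_ → ∀ a → Convex _≼_ ⁅ a ⁆
⁅⁆-convex antisym a p q r p∈⁅a⁆ r∈⁅a⁆ p≼q q≼r
  with refl ← x∈⁅y⁆⇒x≡y a p∈⁅a⁆ | refl ← x∈⁅y⁆⇒x≡y a r∈⁅a⁆ =
  subst (_∈ ⁅ a ⁆) (antisym p≼q q≼r) (x∈⁅x⁆ a)

Nonempty[p∩⁅x⁆]⇔x∈p : ∀ {n} {p : Subset n} {x} → Nonempty (p ∩ ⁅ x ⁆) ⇔ x ∈ p
Nonempty[p∩⁅x⁆]⇔x∈p {p = p} {x} = mk⇔ to (λ x∈p → x , x∈p∩q⁺ (x∈p , x∈⁅x⁆ x))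
  where
  to : Nonempty (p ∩ ⁅ x ⁆) → x ∈ p
  to (y , y∈p∩⁅x⁆) with x∈p∩q⁻ p ⁅ x ⁆ y∈p∩⁅x⁆
  ... | y∈p , y∈⁅x⁆ = subst (_∈ p) (x∈⁅y⁆⇒x≡y x y∈⁅x⁆) y∈p

module TotallyOrderedFin {n} {_≼_ : Rel (Fin n) 0ℓ} (≼-isTotalOrder : IsTotalOrder _≡_ _≼_) where
  open IsTotalOrder ≼-isTotalOrder using (total; antisym; reflexive) renaming (trans to ≼-trans)

  _≼?_ : Decidable _≼_
  _≼?_ = total∧dec⇒dec reflexive antisym total _≟_

  below : Fin n → Subset n
  below a = tabulate (λ b → does (b ≼? a))

  ∈below⇔ : ∀ {a b} → b ∈ below a ⇔ b ≼ a
  ∈below⇔ {a} {b} = mk⇔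
    (λ b∈below → invert (subst (Reflects (b ≼ a))
      (trans (sym (lookup∘tabulate _ b)) ([]=⇒lookup b∈below)) (proof (b ≼? a))))
    (λ b≼a → lookup⇒[]= b (below a) (trans (lookup∘tabulate _ b) (dec-true (b ≼? a) b≼a)))

  below-mono : ∀ {a b} → a ≼ b → below a ⊆ below b
  below-mono a≼b x∈below = Equivalence.from ∈below⇔ (≼-trans (Equivalence.to ∈below⇔ x∈below) a≼b)

  below-strict : ∀ {a b} → a ≼ b → a ≢ b → below a ⊂ below b
  below-strict {a} {b} a≼b a≢b =
    below-mono a≼b , b , Equivalence.from ∈below⇔ (reflexive refl) ,
    λ b∈below → a≢b (antisym a≼b (Equivalence.to ∈below⇔ b∈below))

  rank : Fin n → ℕ
  rank a = ∣ below a ∣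

  rank-mono : ∀ {a b} → a ≼ b → rank a ≤ rank b
  rank-mono = p⊆q⇒∣p∣≤∣q∣ ∘ below-mono

  rank-cancel : ∀ {a b} → rank a ≤ rank b → a ≼ b
  rank-cancel {a} {b} ra≤rb with total a b | b ≟ a
  ... | inj₁ a≼b | _ = a≼b
  ... | inj₂ _ | yes refl = reflexive refl
  ... | inj₂ b≼a | no b≢a = contradiction ra≤rb (<⇒≱ (p⊂q⇒∣p∣<∣q∣ (below-strict b≼a b≢a)))

  rank-isOrderMonomorphism : IsOrderMonomorphism _≡_ _≡_ _≼_ _≤_ rank
  rank-isOrderMonomorphism = record
    { isOrderHomomorphism = record { cong = cong rank ; mono = rank-mono }
    ; injective = λ ra≡rb →
        antisym (rank-cancel (≤-reflexive ra≡rb)) (rank-cancel (≤-reflexive (sym ra≡rb)))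
    ; cancel = rank-cancel
    }

  ≼-totalOrder : TotalOrder 0ℓ 0ℓ 0ℓ
  ≼-totalOrder = record { isTotalOrder = ≼-isTotalOrder }

  open Data.List.Extrema ≼-totalOrder using (min; max; argmin-all; argmax-all; min≤xs; xs≤max)

  members : Subset n → List (Fin n)
  members A = filter (_∈? A) (allFin n)

  ∈members : ∀ {A x} → x ∈ A → x ∈ˡ members A
  ∈members x∈A = ∈-filter⁺ (_∈? _) (∈-allFin _) x∈A

  least greatest : (A : Subset n) → Nonempty A → Fin n
  least A (a , _) = min a (members A)
  greatest A (a , _) = max a (members A)

  least∈ : ∀ A ne → least A ne ∈ A
  least∈ A (_ , a∈A) = argmin-all id a∈A (all-filter (_∈? A) (allFin n))

  greatest∈ : ∀ A ne → greatest A ne ∈ A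
  greatest∈ A (_ , a∈A) = argmax-all id a∈A (all-filter (_∈? A) (allFin n))

  least≼ : ∀ A ne {x} → x ∈ A → least A ne ≼ x
  least≼ A (a , _) x∈A = lookup (min≤xs a (members A)) (∈members x∈A)

  ≼greatest : ∀ A ne {x} → x ∈ A → x ≼ greatest A ne
  ≼greatest A (a , _) x∈A = lookup (xs≤max a (members A)) (∈members x∈A)

  between∈ : ∀ {A} ne → Convex _≼_ A → ∀ {x} → least A ne ≼ x → x ≼ greatest A ne → x ∈ A
  between∈ {A} ne A-convex = A-convex _ _ _ (least∈ A ne) (greatest∈ A ne)

  convex-overlap : ∀ {A B} neA neB → Convex _≼_ A → Convex _≼_ B →
    least A neA ≼ greatest B neB → least B neB ≼ greatest A neA → Nonempty (A ∩ B)
  convex-overlap {A} {B} neA neB A-convex B-convex lA≼gB lB≼gA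
    with total (least A neA) (least B neB)
  ... | inj₁ lA≼lB = least B neB , x∈p∩q⁺ (between∈ neA A-convex lA≼lB lB≼gA , least∈ B neB)
  ... | inj₂ lB≼lA = least A neA , x∈p∩q⁺ (least∈ A neA , between∈ neB B-convex lB≼lA lA≼gB)

  convex-⊆ : ∀ {A B} neA neB → Convex _≼_ B →
    least A neA ≡ least B neB → greatest A neA ≡ greatest B neB → A ⊆ B
  convex-⊆ {A} neA neB B-convex lA≡lB gA≡gB x∈A =
    between∈ neB B-convex
      (subst (_≼ _) lA≡lB (least≼ A neA x∈A)) (subst (_ ≼_) gA≡gB (≼greatest A neA x∈A))

module IntervalRepresentation {n} {C : Pred (Subset n) 0ℓ} {_≼_ : Rel (Fin n) 0ℓ}
  (≼-isTotalOrder : IsTotalOrder _≡_ _≼_) (C-convex : ∀ A → C A → Convex _≼_ A) where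
  open TotallyOrderedFin ≼-isTotalOrder
  open IsOrderMonomorphism rank-isOrderMonomorphism using (mono; cancel; injective)
  open IsTotalOrder ≼-isTotalOrder using (antisym)

  Vertex : Set
  Vertex = Σ (Subset n) (Plus C)

  nonempty : (v : Vertex) → Nonempty (proj₁ v)
  nonempty (_ , inj₁ (_ , ne)) = ne
  nonempty (_ , inj₂ (a , refl)) = a , x∈⁅x⁆ a

  convex : (v : Vertex) → Convex _≼_ (proj₁ v)
  convex (A , inj₁ (A∈C , _)) = C-convex A A∈C
  convex (_ , inj₂ (a , refl)) = ⁅⁆-convex antisym a

  bottom top : Vertex → Fin n
  bottom v = least (proj₁ v) (nonempty v)
  top v = greatest (proj₁ v) (nonempty v)

  bottom≼ : ∀ v {x} → x ∈ proj₁ v → bottom v ≼ x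
  bottom≼ v = least≼ (proj₁ v) (nonempty v)

  ≼top : ∀ v {x} → x ∈ proj₁ v → x ≼ top v
  ≼top v = ≼greatest (proj₁ v) (nonempty v)

  rank-bottom≤rank-top : ∀ v → rank (bottom v) ≤ rank (top v)
  rank-bottom≤rank-top v = mono (bottom≼ v (greatest∈ (proj₁ v) (nonempty v)))

  interval : Vertex → Interval
  interval v = span (rank (bottom v)) (rank (top v)) (rank-bottom≤rank-top v)

  interval-injective : ∀ v w → (∀ x → x ∈ᵢ interval v ⇔ x ∈ᵢ interval w) → proj₁ v ≡ proj₁ w
  interval-injective v w same = ⊆-antisym
    (convex-⊆ (nonempty v) (nonempty w) (convex w) bottom≡ top≡)
    (convex-⊆ (nonempty w) (nonempty v) (convex v) (sym bottom≡) (sym top≡))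
    where
    ends≡ : lo (interval v) ≡ lo (interval w) × hi (interval v) ≡ hi (interval w)
    ends≡ = samePoints⇒≡ends (interval v) (interval w) same
    bottom≡ : bottom v ≡ bottom w
    bottom≡ = injective (*-cancelˡ-≡ _ _ 2 (fromℕ-injective (proj₁ ends≡)))
    top≡ : top v ≡ top w
    top≡ = injective (*-cancelˡ-≡ _ _ 2 (suc-injective (fromℕ-injective (proj₂ ends≡))))

  ∈⇒point∈interval : ∀ v {x} → x ∈ proj₁ v → fromℕ (2 * rank x) ∈ᵢ interval v
  ∈⇒point∈interval v x∈v =
    even∈span (rank-bottom≤rank-top v) (mono (bottom≼ v x∈v)) (mono (≼top v x∈v))

  meet⇒bottom≼top : ∀ v w → Meet (interval v) (interval w) → bottom v ≼ top w
  meet⇒bottom≼top v w meet =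
    cancel (2*m≤1+2*n⇒m≤n (fromℕ-cancel-≤ (meet⇒lo≤hi (interval v) (interval w) meet)))

  overlap⇔meet : ∀ v w → Nonempty (proj₁ v ∩ proj₁ w) ⇔ Meet (interval v) (interval w)
  overlap⇔meet v w = mk⇔
    (λ (x , x∈v∩w) → let x∈v , x∈w = x∈p∩q⁻ (proj₁ v) (proj₁ w) x∈v∩w in
      fromℕ (2 * rank x) , ∈⇒point∈interval v x∈v , ∈⇒point∈interval w x∈w)
    (λ meet → convex-overlap (nonempty v) (nonempty w) (convex v) (convex w)
      (meet⇒bottom≼top v w meet) (meet⇒bottom≼top w v (Meet-sym (interval v) (interval w) meet)))

  isIntervalGraph : IsIntervalGraph (Plus C)
  isIntervalGraph = interval , interval-injective , λ v w _ → overlap⇔meet v w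

module OrderFromIntervals {n} {C : Pred (Subset n) 0ℓ} (f : Σ (Subset n) (Plus C) → Interval)
  (f-adjacency : ∀ v w → proj₁ v ≢ proj₁ w → Nonempty (proj₁ v ∩ proj₁ w) ⇔ Meet (f v) (f w)) where

  singleton : Fin n → Σ (Subset n) (Plus C)
  singleton a = ⁅ a ⁆ , inj₂ (a , refl)

  I : Fin n → Interval
  I = f ∘ singleton

  meet⇒∈ : ∀ v {a} → Meet (f v) (I a) → a ∈ proj₁ v
  meet⇒∈ (A , A⁺) {a} meet with A ≟ₛ ⁅ a ⁆
  ... | yes refl = x∈⁅x⁆ a
  ... | no A≢⁅a⁆ = Equivalence.to Nonempty[p∩⁅x⁆]⇔x∈p
    (Equivalence.from (f-adjacency (A , A⁺) (singleton a) A≢⁅a⁆) meet)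

  ∈⇒meet : ∀ v {a} → proj₁ v ≢ ⁅ a ⁆ → a ∈ proj₁ v → Meet (f v) (I a)
  ∈⇒meet v {a} v≢⁅a⁆ a∈v =
    Equivalence.to (f-adjacency v (singleton a) v≢⁅a⁆) (Equivalence.from Nonempty[p∩⁅x⁆]⇔x∈p a∈v)

  lo∘I-injective : Injective _≡_ _≡_ (lo ∘ I)
  lo∘I-injective {a} {b} loa≡lob =
    sym (x∈⁅y⁆⇒x≡y a (meet⇒∈ _ (lo (I b) , subst (_∈ᵢ I a) loa≡lob (lo∈ (I a)) , lo∈ (I b))))

  _⊑_ : Rel (Fin n) 0ℓ
  _⊑_ = _≤ℚ_ on (lo ∘ I)

  ⊑-isTotalOrder : IsTotalOrder _≡_ _⊑_
  ⊑-isTotalOrder = OrderMonomorphism.isTotalOrder lo∘I-isOrderMonomorphism ℚ.≤-isTotalOrder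
    where
    lo∘I-isOrderMonomorphism : IsOrderMonomorphism _≡_ _≡_ _⊑_ _≤ℚ_ (lo ∘ I)
    lo∘I-isOrderMonomorphism = record
      { isOrderHomomorphism = record { cong = cong (lo ∘ I) ; mono = id }
      ; injective = lo∘I-injective
      ; cancel = id
      }

  I-separated : ∀ {a b} → a ≢ b → a ⊑ b → hi (I a) <ℚ lo (I b)
  I-separated {a} {b} a≢b a⊑b = ℚ.≰⇒> λ lob≤hia →
    a≢b (sym (x∈⁅y⁆⇒x≡y a (meet⇒∈ _ (lo (I b) , (a⊑b , lob≤hia) , lo∈ (I b)))))

  open IsTotalOrder ⊑-isTotalOrder using () renaming (antisym to ⊑-antisym)

  C-convex : ∀ A → C A → Convex _⊑_ A
  C-convex A A∈C p q r p∈A r∈A p⊑q q⊑r with A ≟ₛ ⁅ p ⁆ | A ≟ₛ ⁅ r ⁆ | p ≟ q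
  ... | yes refl | _ | _ = ⁅⁆-convex ⊑-antisym p p q r p∈A r∈A p⊑q q⊑r
  ... | _ | yes refl | _ = ⁅⁆-convex ⊑-antisym r p q r p∈A r∈A p⊑q q⊑r
  ... | _ | _ | yes refl = p∈A
  ... | no A≢⁅p⁆ | no A≢⁅r⁆ | no p≢q =
    meet⇒∈ v (lo (I q) , (lo[fv]≤lo[Iq] , lo[Iq]≤hi[fv]) , lo∈ (I q))
    where
    open ℚ.≤-Reasoning
    v : Σ (Subset n) (Plus C)
    v = A , inj₁ (A∈C , p , p∈A)
    lo[fv]≤lo[Iq] : lo (f v) ≤ℚ lo (I q)
    lo[fv]≤lo[Iq] = begin
      lo (f v)  ≤⟨ meet⇒lo≤hi (f v) (I p) (∈⇒meet v A≢⁅p⁆ p∈A) ⟩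
      hi (I p)  <⟨ I-separated p≢q p⊑q ⟩
      lo (I q)  ∎
    lo[Iq]≤hi[fv] : lo (I q) ≤ℚ hi (f v)
    lo[Iq]≤hi[fv] = begin
      lo (I q)  ≤⟨ q⊑r ⟩
      lo (I r)  ≤⟨ meet⇒lo≤hi (I r) (f v) (Meet-sym (f v) (I r) (∈⇒meet v A≢⁅r⁆ r∈A)) ⟩
      hi (f v)  ∎

proposition7p1 : (n : ℕ) (C : Pred (Subset n) 0ℓ) →
    (∃ λ (R : Rel (Fin n) 0ℓ) → IsTotalOrder _≡_ R × (∀ A → C A → Convex R A))
      ⇔ IsIntervalGraph (Plus C)
proposition7p1 n C = mk⇔
  (λ (_ , ≼-isTotalOrder , C-convex) →
    IntervalRepresentation.isIntervalGraph ≼-isTotalOrder C-convex)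
  (λ (f , _ , f-adjacency) →
    let open OrderFromIntervals f f-adjacency in _⊑_ , ⊑-isTotalOrder , C-convex)
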